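{- Let $A,O,E$ be non-empty sets each equipped with an equivalence relation, and let $\phi\subseteq A\times O\times E$. Then for all $X\subseteq A$ and $Y\subseteq O$: (1) $\langle\overline{\phi}\rangle_E(X,Y)=\overline{\alpha}_E(\phi)(X,Y)$; (2) $\overline{\langle\phi\rangle_E(\overline{X},\overline{Y})}=\overline{\alpha}_E(\phi)(X,Y)$; (3) $[[\underline{\phi}]]_E(X,Y)\subseteq\underline{\alpha}_E(\phi)(X,Y)$; (4) $\underline{[[\phi]]_E(\underline{X},\underline{Y})}=\underline{\alpha}_E(\phi)(X,Y)$.
   Context: For an element $x$ of $A$ (resp. $O$, $E$), $[x]$ denotes its equivalence class. For a subset $X$ of one of these sets, $\overline{X}=\{z:[z]\cap X\neq\emptyset\}$ and $\underline{X}=\{z:[z]\subseteq X\}$. For $\psi\subseteq A\times O\times E$: $\overline{\psi}=\{\langle a,o,e\rangle:([a]\times[o]\times[e])\cap\psi\neq\emptyset\}$, $\underline{\psi}=\{\langle a,o,e\rangle:[a]\times[o]\times[e]\subseteq\psi\}$; $\langle\psi\rangle_E(X,Y)=\{e\in E:(X\times Y\times\{e\})\cap\psi\neq\emptyset\}$; $[[\psi]]_E(X,Y)=\{e\in E:X\times Y\times\{e\}\subseteq\psi\}$; $e\in\overline{\alpha}_E(\psi)(X,Y)\iff(\overline{X}\times\overline{Y}\times[e])\cap\psi\neq\emptyset$; $e\in\underline{\alpha}_E(\psi)(X,Y)\iff\underline{X}\times\underline{Y}\times[e]\subseteq\psi$. -}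

module Defs where

open import Level using (Level; _⊔_; suc)
open import Data.Product using (Σ; ∃; _×_; _,_)
open import Relation.Binary using (Rel; IsEquivalence)

Subset : ∀ {a} → Set a → (ℓ : Level) → Set (a ⊔ suc ℓ)
Subset A ℓ = A → Set ℓ

_⊆_ : ∀ {a ℓ₁ ℓ₂} {A : Set a} → Subset A ℓ₁ → Subset A ℓ₂ → Set (a ⊔ ℓ₁ ⊔ ℓ₂)
P ⊆ Q = ∀ x → P x → Q x

_≐_ : ∀ {a ℓ₁ ℓ₂} {A : Set a} → Subset A ℓ₁ → Subset A ℓ₂ → Set (a ⊔ ℓ₁ ⊔ ℓ₂)
P ≐ Q = (P ⊆ Q) × (Q ⊆ P)

module Approx {a o e ℓa ℓo ℓe : Level}
  {A : Set a} {O : Set o} {E : Set e}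
  (_≈A_ : Rel A ℓa) (_≈O_ : Rel O ℓo) (_≈E_ : Rel E ℓe) where

  -- upper / lower approximation of a subset w.r.t. an equivalence relation:
  -- [z] ∩ X ≠ ∅ means ∃ w. z ≈ w ∧ w ∈ X ; [z] ⊆ X means ∀ w. z ≈ w → w ∈ X
  upper : ∀ {c ℓ r} {C : Set c} → Rel C r → Subset C ℓ → Subset C (c ⊔ ℓ ⊔ r)
  upper _≈_ X z = ∃ λ w → (z ≈ w) × X w

  lower : ∀ {c ℓ r} {C : Set c} → Rel C r → Subset C ℓ → Subset C (c ⊔ ℓ ⊔ r)
  lower _≈_ X z = ∀ w → z ≈ w → X w

  Ternary : (ℓ : Level) → Set (a ⊔ o ⊔ e ⊔ suc ℓ)
  Ternary ℓ = A → O → E → Set ℓ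

  upperT : ∀ {ℓ} → Ternary ℓ → Ternary (a ⊔ o ⊔ e ⊔ ℓa ⊔ ℓo ⊔ ℓe ⊔ ℓ)
  upperT ψ x y z = ∃ λ x' → ∃ λ y' → ∃ λ z' →
    (x ≈A x') × (y ≈O y') × (z ≈E z') × ψ x' y' z'

  lowerT : ∀ {ℓ} → Ternary ℓ → Ternary (a ⊔ o ⊔ e ⊔ ℓa ⊔ ℓo ⊔ ℓe ⊔ ℓ)
  lowerT ψ x y z = ∀ x' y' z' →
    x ≈A x' → y ≈O y' → z ≈E z' → ψ x' y' z'

  possE : ∀ {ℓ ℓ₁ ℓ₂} → Ternary ℓ → Subset A ℓ₁ → Subset O ℓ₂
        → Subset E (a ⊔ o ⊔ ℓ ⊔ ℓ₁ ⊔ ℓ₂)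
  possE ψ X Y z = ∃ λ x → ∃ λ y → X x × Y y × ψ x y z

  necE : ∀ {ℓ ℓ₁ ℓ₂} → Ternary ℓ → Subset A ℓ₁ → Subset O ℓ₂
       → Subset E (a ⊔ o ⊔ ℓ ⊔ ℓ₁ ⊔ ℓ₂)
  necE ψ X Y z = ∀ x y → X x → Y y → ψ x y z

  upperαE : ∀ {ℓ ℓ₁ ℓ₂} → Ternary ℓ → Subset A ℓ₁ → Subset O ℓ₂
          → Subset E (a ⊔ o ⊔ e ⊔ ℓa ⊔ ℓo ⊔ ℓe ⊔ ℓ ⊔ ℓ₁ ⊔ ℓ₂)
  upperαE ψ X Y z = ∃ λ x → ∃ λ y → ∃ λ z' →
    upper _≈A_ X x × upper _≈O_ Y y × (z ≈E z') × ψ x y z'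

  lowerαE : ∀ {ℓ ℓ₁ ℓ₂} → Ternary ℓ → Subset A ℓ₁ → Subset O ℓ₂
          → Subset E (a ⊔ o ⊔ e ⊔ ℓa ⊔ ℓo ⊔ ℓe ⊔ ℓ ⊔ ℓ₁ ⊔ ℓ₂)
  lowerαE ψ X Y z = ∀ x y z' →
    lower _≈A_ X x → lower _≈O_ Y y → z ≈E z' → ψ x y z'

{-# OPTIONS --safe #-}
-- Each identity is a reordering of the same existential (resp. universal)
-- quantifiers.  Only (1) needs symmetry, to move x ≈ x' from the approximated
-- relation onto the approximated sets, and only (3) needs reflexivity, to
-- instantiate the lower approximation at the point itself.
module Submission where

open import Defs
open import Level using (Level)
open import Data.Product using (_×_; _,_)
open import Relation.Binary using (Rel; IsEquivalence)
open import Relation.Binary.Definitions using (Reflexive; Symmetric)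

module _ {a o e ℓa ℓo ℓe : Level} {A : Set a} {O : Set o} {E : Set e}
         {_≈A_ : Rel A ℓa} {_≈O_ : Rel O ℓo} {_≈E_ : Rel E ℓe} where

  open Approx _≈A_ _≈O_ _≈E_

  module _ {ℓ ℓ₁ ℓ₂ : Level} (φ : Ternary ℓ) (X : Subset A ℓ₁) (Y : Subset O ℓ₂) where

    possE-upperT≐upperαE : Symmetric _≈A_ → Symmetric _≈O_
                         → possE (upperT φ) X Y ≐ upperαE φ X Y
    possE-upperT≐upperαE symA symO = to , from
      where
      to : possE (upperT φ) X Y ⊆ upperαE φ X Y
      to _ (x , y , Xx , Yy , x' , y' , z' , x≈x' , y≈y' , z≈z' , φx'y'z') =
        x' , y' , z' , (x , symA x≈x' , Xx) , (y , symO y≈y' , Yy) , z≈z' , φx'y'z'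

      from : upperαE φ X Y ⊆ possE (upperT φ) X Y
      from _ (x , y , z' , (x' , x≈x' , Xx') , (y' , y≈y' , Yy') , z≈z' , φxyz') =
        x' , y' , Xx' , Yy' , x , y , z' , symA x≈x' , symO y≈y' , z≈z' , φxyz'

    upper-possE-upper≐upperαE :
      upper _≈E_ (possE φ (upper _≈A_ X) (upper _≈O_ Y)) ≐ upperαE φ X Y
    upper-possE-upper≐upperαE = to , from
      where
      to : upper _≈E_ (possE φ (upper _≈A_ X) (upper _≈O_ Y)) ⊆ upperαE φ X Y
      to _ (z' , z≈z' , x , y , X̄x , Ȳy , φxyz') = x , y , z' , X̄x , Ȳy , z≈z' , φxyz'

      from : upperαE φ X Y ⊆ upper _≈E_ (possE φ (upper _≈A_ X) (upper _≈O_ Y))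
      from _ (x , y , z' , X̄x , Ȳy , z≈z' , φxyz') = z' , z≈z' , x , y , X̄x , Ȳy , φxyz'

    necE-lowerT⊆lowerαE : Reflexive _≈A_ → Reflexive _≈O_
                        → necE (lowerT φ) X Y ⊆ lowerαE φ X Y
    necE-lowerT⊆lowerαE reflA reflO _ nec x y z' X̲x Y̲y z≈z' =
      nec x y (X̲x x reflA) (Y̲y y reflO) x y z' reflA reflO z≈z'

    lower-necE-lower≐lowerαE :
      lower _≈E_ (necE φ (lower _≈A_ X) (lower _≈O_ Y)) ≐ lowerαE φ X Y
    lower-necE-lower≐lowerαE = to , from
      where
      to : lower _≈E_ (necE φ (lower _≈A_ X) (lower _≈O_ Y)) ⊆ lowerαE φ X Y
      to _ h x y z' X̲x Y̲y z≈z' = h z' z≈z' x y X̲x Y̲y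

      from : lowerαE φ X Y ⊆ lower _≈E_ (necE φ (lower _≈A_ X) (lower _≈O_ Y))
      from _ h z' z≈z' x y X̲x Y̲y = h x y z' X̲x Y̲y z≈z'

mainTheorem8 : ∀ {a o e ℓa ℓo ℓe ℓ ℓ₁ ℓ₂ : Level}
    {A : Set a} {O : Set o} {E : Set e}
    (_≈A_ : Rel A ℓa) (_≈O_ : Rel O ℓo) (_≈E_ : Rel E ℓe)
    → IsEquivalence _≈A_ → IsEquivalence _≈O_ → IsEquivalence _≈E_
    → A → O → E
    → (φ : A → O → E → Set ℓ) (X : Subset A ℓ₁) (Y : Subset O ℓ₂)
    → let open Approx _≈A_ _≈O_ _≈E_ in
      (possE (upperT φ) X Y ≐ upperαE φ X Y)
      × (upper _≈E_ (possE φ (upper _≈A_ X) (upper _≈O_ Y)) ≐ upperαE φ X Y)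
      × (necE (lowerT φ) X Y ⊆ lowerαE φ X Y)
      × (lower _≈E_ (necE φ (lower _≈A_ X) (lower _≈O_ Y)) ≐ lowerαE φ X Y)
mainTheorem8 _ _ _ eqA eqO _ _ _ _ φ X Y =
    possE-upperT≐upperαE φ X Y (IsEquivalence.sym eqA) (IsEquivalence.sym eqO)
  , upper-possE-upper≐upperαE φ X Y
  , necE-lowerT⊆lowerαE φ X Y (IsEquivalence.refl eqA) (IsEquivalence.refl eqO)
  , lower-necE-lower≐lowerαE φ X Y
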